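{- Let $D \neq 1$ be a square-free integer, let $p$ be an odd prime, let $k,\ell$ be positive integers, and let $c_D$ be a positive integer with $\gcd(c_D k, p) = 1$. Let $N = c_D k p^\ell - 1$ be an odd prime with Jacobi symbol $\left(\frac{D}{N}\right) = -1$, and let $w \in \mathcal{G}_N(D)$. Then one of the following holds: (i) $w^{c_D k} \equiv 1 \pmod N$; (ii) there exists an integer $j$ with $0 \le j < \ell$ such that $\Phi_p\bigl(w^{c_D k p^j}\bigr) \equiv 0 \pmod N$, where $\Phi_p(x) = x^{p-1} + \dots + x + 1$ is the $p$-th cyclotomic polynomial.
   Context: For an integer $n \ge 2$ and square-free $D \neq 1$: if $D \equiv 2,3 \pmod 4$, let $\mathcal{I}_n(D) = \{a + b\sqrt{D} : a,b \in \mathbb{Z}/n\mathbb{Z}\}$ (the ring $\mathbb{Z}[\sqrt D]/n\mathbb{Z}[\sqrt D]$) and $\mathcal{G}_n(D) = \{a + b\sqrt{D} \in \mathcal{I}_n(D) : a^2 - Db^2 \equiv 1 \pmod n\}$. If $D \equiv 1 \pmod 4$, let $\omega = \frac{1+\sqrt D}{2}$, $\mathcal{I}_n(D) = \{a + b\omega : a,b \in \mathbb{Z}/n\mathbb{Z}\}$ (the ring $\mathbb{Z}[\omega]/n\mathbb{Z}[\omega]$) and $\mathcal{G}_n(D) = \{a + b\omega \in \mathcal{I}_n(D) : a^2 + ab + \frac{1-D}{4} b^2 \equiv 1 \pmod n\}$. $\mathcal{G}_n(D)$ is a group under the multiplication of $\mathcal{I}_n(D)$. A congruence $x \equiv y \pmod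 n$ between elements of $\mathcal{I}_n(D)$ means $x = y$ in $\mathcal{I}_n(D)$. -}

module Defs where

open import Data.Bool using (Bool; true; false; if_then_else_)
open import Data.Nat as ℕ using (ℕ; zero; suc; _≡ᵇ_; _≤ᵇ_)
import Data.Nat.DivMod as ℕD
open import Data.Integer as ℤ using (ℤ; +_; _+_; _*_; _-_; -_; ∣_∣)
open import Data.Integer.DivMod using (_%ℕ_; _/ℕ_)
open import Data.Integer.Divisibility using () renaming (_∣_ to _∣ℤ_)
open import Data.List using (List; []; _∷_; foldr; upTo)
open import Data.Bool.ListAction using (any)
open import Data.Product using (_×_; _,_)
open import Relation.Binary.PropositionalEquality using (_≡_)

-- Square-free integers: no square of an integer m > 1 divides D.
-- (In particular D = 0 is not square-free.)

SquareFree : ℤ → Set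
SquareFree D = ∀ (m : ℕ) → (m ℕ.* m) Data.Nat.Divisibility.∣ ∣ D ∣ → m ≡ 1
  where import Data.Nat.Divisibility

legendre : ℤ → ℕ → ℤ
legendre a zero = + 0
legendre a (suc q) =
  if (a %ℕ suc q) ≡ᵇ 0 then + 0
  else if any (λ x → ((+ x * + x - a) %ℕ suc q) ≡ᵇ 0) (upTo (suc q)) then + 1
  else - (+ 1)

-- Prime factorisation (with multiplicity) by trial division.
-- factorsAux fuel e n : prime factors of n that are ≥ 2 + e, trying
-- the divisor d = 2 + e first.
factorsAux : ℕ → ℕ → ℕ → List ℕ
factorsAux zero e n = []
factorsAux (suc f) e n =
  if n ≤ᵇ 1 then []
  else if (n ℕD.% suc (suc e)) ≡ᵇ 0
       then suc (suc e) ∷ factorsAux f e (n ℕD./ suc (suc e))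
       else factorsAux f (suc e) n

-- enough fuel: each step either divides n or increments the divisor
primeFactors : ℕ → List ℕ
primeFactors n = factorsAux (2 ℕ.* n ℕ.+ 2) 0 n

jacobi : ℤ → ℕ → ℤ
jacobi a n = foldr (λ p r → legendre a p * r) (+ 1) (primeFactors n)

-- The ring I_n(D) = Z[√D]/n or Z[ω]/n, elements represented by
-- integer pairs (a , b) meaning a + b√D (D ≡ 2,3 mod 4) or a + bω
-- (D ≡ 1 mod 4, ω = (1+√D)/2), with equality up to congruence mod n.

Elt : Set
Elt = ℤ × ℤ

D≡1mod4 : ℤ → Bool
D≡1mod4 D = (D %ℕ 4) ≡ᵇ 1

mul : ℤ → Elt → Elt → Elt
mul D (a , b) (c , d) =
  if D≡1mod4 D
  -- ω² = ω + (D-1)/4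
  then (a * c + b * d * ((D - + 1) /ℕ 4) , a * d + b * c + b * d)
  else (a * c + D * b * d , a * d + b * c)

add : Elt → Elt → Elt
add (a , b) (c , d) = (a + c , b + d)

one : Elt
one = (+ 1 , + 0)

zeroE : Elt
zeroE = (+ 0 , + 0)

norm : ℤ → Elt → ℤ
norm D (a , b) =
  if D≡1mod4 D
  then a * a + a * b + ((+ 1 - D) /ℕ 4) * b * b
  else a * a - D * b * b

infix 4 _≡ℤ[_]_ _≡[_]_

_≡ℤ[_]_ : ℤ → ℕ → ℤ → Set
x ≡ℤ[ n ] y = (+ n) ∣ℤ (x - y)

_≡[_]_ : Elt → ℕ → Elt → Set
(a , b) ≡[ n ] (c , d) = (a ≡ℤ[ n ] c) × (b ≡ℤ[ n ] d)

InG : ℕ → ℤ → Elt → Set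
InG n D w = norm D w ≡ℤ[ n ] + 1

pow : ℤ → Elt → ℕ → Elt
pow D w zero = one
pow D w (suc m) = mul D w (pow D w m)

cyclo : ℤ → ℕ → Elt → Elt
cyclo D zero x = zeroE
cyclo D (suc m) x = add (pow D x m) (cyclo D m x)

-- Since the Jacobi symbol of D modulo the prime N is -1, D is not a square modulo N, and
-- Euler's criterion (pair each unit x with D / x and compare with Wilson's theorem) gives
-- D ^ ((N - 1) / 2) ≡ -1. In ℤ[ω]/N the Frobenius x ↦ x ^ N therefore fixes ℤ and negates a
-- square root of the discriminant, so it is the conjugation, and w ^ (N + 1) is the norm of w,
-- which is 1. The norm is multiplicative and vanishes only at 0, so ℤ[ω]/N has no zero
-- divisors. With v_j = w ^ (c k p ^ j) we have v_ℓ = w ^ (N + 1) = 1 and v_(j+1) = v_j ^ p;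
-- since (v - 1) Φ_p(v) = v ^ p - 1, descending from j = ℓ yields (i) or (ii).

module Submission where

open import Algebra.Bundles using (CommutativeRing; CommutativeSemiring)
open import Algebra.Core using (Op₁; Op₂)
open import Algebra.Definitions using (Congruent₁; Congruent₂)
import Algebra.Properties.Semiring.Mult
open import Algebra.Structures using (IsCommutativeRing)
open import Data.Bool using (Bool; true; false; T; if_then_else_)
open import Data.Bool.ListAction using (any)
open import Data.Fin using (Fin; zero; toℕ; inject₁; fromℕ)
open import Data.Fin.Properties using (toℕ-inject₁; toℕ-fromℕ; toℕ<n)
open import Data.List using (List; []; _∷_; length; filter; applyUpTo; upTo)
open import Data.List.Membership.Propositional using (_∈_; _∉_; lose)
open import Data.List.Membership.Propositional.Properties using (∈-applyUpTo⁺; ∈-applyUpTo⁻; ∈-upTo⁺; ∈-filter⁺; ∈-filter⁻)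
open import Data.List.Properties using (filter-accept; filter-reject; filter-all; applyUpTo-∷ʳ; length-applyUpTo)
open import Data.List.Relation.Binary.Permutation.Propositional using (_↭_; ↭-refl; ↭-prep; ↭-swap; ↭-reflexive; module PermutationReasoning)
open import Data.List.Relation.Binary.Permutation.Propositional.Properties using (↭-length)
open import Data.List.Relation.Unary.All as All using ()
open import Data.List.Relation.Unary.AllPairs using (_∷_)
open import Data.List.Relation.Unary.Any using (here; there)
open import Data.List.Relation.Unary.Any.Properties using (any⁺)
open import Data.List.Relation.Unary.Unique.Propositional using (Unique)
open import Data.List.Relation.Unary.Unique.Propositional.Properties using (applyUpTo⁺₁; filter⁺; Unique[x∷xs]⇒x∉xs)
open import Data.Nat as ℕ using (ℕ; zero; suc; _∸_; _!; _/_; _≟_; _≡ᵇ_; z≤n; s≤s)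
open import Data.Nat.Combinatorics using (_C_; k![n∸k]!∣n!; nCn≡1)
open import Data.Nat.Combinatorics.Specification using (nCk≡n!/k![n-k]!)
open import Data.Nat.DivMod using (m*[n/m]≡n; n%n≡0; n/n≡1; m≡m%n+[m/n]*n)
open import Data.Nat.Divisibility using (_∣_; divides; ∣⇒≤; >⇒∤; m∣m*n; m%n≡0⇒n∣m)
open import Data.Nat.GCD using (gcd)
open import Data.Nat.ListAction using (product)
open import Data.Nat.ListAction.Properties using (product-↭; product-++)
open import Data.Nat.Primality using (Prime; composite; euclidsLemma; prime⇒nonTrivial; prime⇒nonZero)
import Data.Nat.Properties as ℕP
open import Data.Product using (Σ; ∃; _,_; proj₁; proj₂)
open import Data.Sum as Sum using (_⊎_; inj₁; inj₂)
open import Data.Vec.Functional using (tail; init; last)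
open import Function using (_∘_; id; flip)
open import Level using (0ℓ)
open import Relation.Binary.Core using (Rel)
open import Relation.Binary.PropositionalEquality as ≡ using (_≡_; _≢_; cong; cong₂; subst; module ≡-Reasoning)
open import Relation.Binary.Structures using (IsEquivalence)
open import Relation.Nullary using (¬_; ¬?; Dec; yes; no; contradiction)
open import Relation.Nullary.Decidable using (map′)

open import Defs

prime≥2 : ∀ {p} → Prime p → 2 ℕ.≤ p
prime≥2 {p} p-prime = ℕ.nonTrivial⇒n>1 p {{prime⇒nonTrivial p-prime}}

isCommutativeRing-coarsen :
  ∀ {A : Set} {_≈_ : Rel A 0ℓ} {_+_ _*_ : Op₂ A} {neg : Op₁ A} {0# 1# : A} →
  IsCommutativeRing _≡_ _+_ _*_ neg 0# 1# → IsEquivalence _≈_ →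
  Congruent₂ _≈_ _+_ → Congruent₂ _≈_ _*_ → Congruent₁ _≈_ neg →
  IsCommutativeRing _≈_ _+_ _*_ neg 0# 1#
isCommutativeRing-coarsen {_≈_ = _≈_} R ≈-equiv +-cong *-cong -‿cong = record
  { isRing = record
    { +-isAbelianGroup = record
      { isGroup = record
        { isMonoid = record
          { isSemigroup = record
            { isMagma = record { isEquivalence = ≈-equiv ; ∙-cong = +-cong }
            ; assoc = λ x y z → ≡⇒≈ (+-assoc x y z) }
          ; identity = ≡⇒≈ ∘ +-identityˡ , ≡⇒≈ ∘ +-identityʳ }
        ; inverse = ≡⇒≈ ∘ -‿inverseˡ , ≡⇒≈ ∘ -‿inverseʳ
        ; ⁻¹-cong = -‿cong }
      ; comm = λ x y → ≡⇒≈ (+-comm x y) }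
    ; *-cong = *-cong
    ; *-assoc = λ x y z → ≡⇒≈ (*-assoc x y z)
    ; *-identity = ≡⇒≈ ∘ *-identityˡ , ≡⇒≈ ∘ *-identityʳ
    ; distrib = (λ x y z → ≡⇒≈ (distribˡ x y z)) , (λ x y z → ≡⇒≈ (distribʳ x y z)) }
  ; *-comm = λ x y → ≡⇒≈ (*-comm x y) }
  where
  open IsCommutativeRing R hiding (+-cong; *-cong; -‿cong)
  ≡⇒≈ : ∀ {x y} → x ≡ y → x ≈ y
  ≡⇒≈ = IsEquivalence.reflexive ≈-equiv

-- Binomial coefficients and the freshman's dream

prime∤! : ∀ {p} → Prime p → ∀ m → m ℕ.< p → ¬ (p ∣ m !)
prime∤! p-prime zero _ p∣1 = ℕP.<⇒≱ (prime≥2 p-prime) (∣⇒≤ p∣1)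
prime∤! p-prime (suc m) m<p p∣m! with euclidsLemma (suc m) (m !) p-prime p∣m!
... | inj₁ p∣1+m = ℕP.<⇒≱ m<p (∣⇒≤ p∣1+m)
... | inj₂ p∣m!  = prime∤! p-prime m (ℕP.<-trans (ℕP.n<1+n m) m<p) p∣m!

C*k!*[n∸k]!≡n! : ∀ {n k} → k ℕ.≤ n → (n C k) ℕ.* (k ! ℕ.* (n ∸ k) !) ≡ n !
C*k!*[n∸k]!≡n! {n} {k} k≤n = begin
  (n C k) ℕ.* k![n∸k]!                 ≡⟨ cong (ℕ._* k![n∸k]!) (nCk≡n!/k![n-k]! k≤n) ⟩
  (n ! / k![n∸k]!) ℕ.* k![n∸k]!        ≡⟨ ℕP.*-comm (n ! / k![n∸k]!) k![n∸k]! ⟩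
  k![n∸k]! ℕ.* (n ! / k![n∸k]!)        ≡⟨ m*[n/m]≡n (k![n∸k]!∣n! k≤n) ⟩
  n !                                  ∎
  where
  open ≡-Reasoning
  k![n∸k]! : ℕ
  k![n∸k]! = k ! ℕ.* (n ∸ k) !
  instance _ = ℕP.m*n≢0 (k !) ((n ∸ k) !) {{ℕP._!≢0 k}} {{ℕP._!≢0 (n ∸ k)}}

prime∣C : ∀ {p k} → Prime p → 0 ℕ.< k → k ℕ.< p → p ∣ p C k
prime∣C {p@(suc p-1)} {k} p-prime k>0 k<p
  with euclidsLemma (p C k) (k ! ℕ.* (p ∸ k) !) p-prime
         (subst (p ∣_) (≡.sym (C*k!*[n∸k]!≡n! (ℕP.<⇒≤ k<p))) (m∣m*n (p-1 !)))
... | inj₁ p∣C = p∣C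
... | inj₂ p∣k!*[p-k]! with euclidsLemma (k !) ((p ∸ k) !) p-prime p∣k!*[p-k]!
...   | inj₁ p∣k!     = contradiction p∣k! (prime∤! p-prime k k<p)
...   | inj₂ p∣[p-k]! = contradiction p∣[p-k]! (prime∤! p-prime (p ∸ k) (ℕP.∸-monoʳ-< k>0 (ℕP.<⇒≤ k<p)))

module _ {c ℓ} (S : CommutativeSemiring c ℓ) where
  open CommutativeSemiring S hiding (zero)
  open import Algebra.Properties.CommutativeSemiring.Binomial S using (theorem; binomialTerm)
  open import Algebra.Properties.Semiring.Exp semiring using (_^_; ^-congʳ)
  open import Algebra.Properties.Semiring.Mult semiring using (_×_; ×-congʳ; ×-assocˡ; ×-assoc-*; ×-homo-1)
  open import Algebra.Properties.Semiring.Sum semiring using (sum; sum-init-last; sum-cong-≋; sum-replicate-zero)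
  open import Relation.Binary.Reasoning.Setoid setoid

  freshmansDream : ∀ {p} → Prime p → p × 1# ≈ 0# → ∀ x y → (x + y) ^ p ≈ x ^ p + y ^ p
  freshmansDream {p@(suc (suc m))} p-prime p×1≈0 x y = begin
    (x + y) ^ p                                            ≈⟨ theorem p x y ⟩
    term zero + sum (tail term)                            ≈⟨ +-congˡ (sum-init-last (tail term)) ⟩
    term zero + (sum (init (tail term)) + last (tail term)) ≈⟨ +-congˡ (+-congʳ inner-terms≈0) ⟩
    term zero + (0# + last (tail term))                    ≈⟨ +-congˡ (+-identityˡ _) ⟩
    term zero + last (tail term)                           ≈⟨ +-cong first-term last-term ⟩
    y ^ p + x ^ p                                          ≈⟨ +-comm _ _ ⟩
    x ^ p + y ^ p                                          ∎
    where
    term : Fin (suc p) → Carrier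
    term = binomialTerm x y p

    p×≈0 : ∀ z → p × z ≈ 0#
    p×≈0 z = begin
      p × z          ≈⟨ ×-congʳ p (*-identityˡ z) ⟨
      p × (1# * z)   ≈⟨ ×-assoc-* p 1# z ⟨
      (p × 1#) * z   ≈⟨ *-congʳ p×1≈0 ⟩
      0# * z         ≈⟨ zeroˡ z ⟩
      0#             ∎

    multiple≈0 : ∀ {c} → p ∣ c → ∀ z → c × z ≈ 0#
    multiple≈0 {c} (divides q c≡q*p) z = begin
      c × z          ≡⟨ cong (_× z) (≡.trans c≡q*p (ℕP.*-comm q p)) ⟩
      (p ℕ.* q) × z  ≈⟨ ×-assocˡ z p q ⟨
      p × (q × z)    ≈⟨ p×≈0 (q × z) ⟩
      0#             ∎

    inner-terms≈0 : sum (init (tail term)) ≈ 0#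
    inner-terms≈0 = trans (sum-cong-≋ inner-term≈0) (sum-replicate-zero (suc m))
      where
      inner-term≈0 : ∀ i → init (tail term) i ≈ 0#
      inner-term≈0 i = multiple≈0 (prime∣C p-prime (s≤s z≤n) (s≤s i<1+m)) _
        where
        i<1+m : toℕ (inject₁ i) ℕ.< suc m
        i<1+m = subst (ℕ._< suc m) (≡.sym (toℕ-inject₁ i)) (toℕ<n i)

    first-term : term zero ≈ y ^ p
    first-term = trans (×-homo-1 _) (*-identityˡ _)

    last-term : last (tail term) ≈ x ^ p
    last-term = top-term {toℕ (fromℕ (suc m))} (toℕ-fromℕ (suc m))
      where
      top-term : ∀ {t} → t ≡ suc m → (p C suc t) × (x ^ suc t * y ^ (p ∸ suc t)) ≈ x ^ p
      top-term ≡.refl = begin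
        (p C p) × (x ^ p * y ^ (p ∸ p))  ≡⟨ cong (_× (x ^ p * y ^ (p ∸ p))) (nCn≡1 p) ⟩
        1 × (x ^ p * y ^ (p ∸ p))        ≈⟨ ×-homo-1 _ ⟩
        x ^ p * y ^ (p ∸ p)              ≈⟨ *-congˡ (^-congʳ y (ℕP.n∸n≡0 p)) ⟩
        x ^ p * 1#                       ≈⟨ *-identityʳ _ ⟩
        x ^ p                            ∎

open import Data.Product using (_×_)

module RootsOfUnity {c ℓ} (R : CommutativeRing c ℓ) where
  open CommutativeRing R
  open import Algebra.Properties.Semiring.Exp semiring using (_^_; ^-congˡ; ^-congʳ; ^-assocʳ)
  open import Algebra.Properties.Ring ring using (x∙y⁻¹≈ε⇒x≈y; [y-z]x≈yx-zx; +-cancelʳ)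
  open import Relation.Binary.Reasoning.Setoid setoid

  geometric : ℕ → Carrier → Carrier
  geometric zero    x = 0#
  geometric (suc m) x = x ^ m + geometric m x

  geometric-cong : ∀ m {x y} → x ≈ y → geometric m x ≈ geometric m y
  geometric-cong zero    _   = refl
  geometric-cong (suc m) x≈y = +-cong (^-congˡ m x≈y) (geometric-cong m x≈y)

  telescope : ∀ m x → x * geometric m x + 1# ≈ x ^ m + geometric m x
  telescope zero    x = begin
    x * 0# + 1#   ≈⟨ +-congʳ (zeroʳ x) ⟩
    0# + 1#       ≈⟨ +-comm 0# 1# ⟩
    1# + 0#       ∎
  telescope (suc m) x = begin
    x * (x ^ m + geometric m x) + 1#        ≈⟨ +-congʳ (distribˡ x (x ^ m) (geometric m x)) ⟩
    x * x ^ m + x * geometric m x + 1#      ≈⟨ +-assoc (x * x ^ m) (x * geometric m x) 1# ⟩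
    x * x ^ m + (x * geometric m x + 1#)    ≈⟨ +-congˡ (telescope m x) ⟩
    x ^ suc m + (x ^ m + geometric m x)     ∎

  module _ (no-zero-divisors : ∀ x y → x * y ≈ 0# → x ≈ 0# ⊎ y ≈ 0#) where

    root-of-unity : ∀ p x → x ^ p ≈ 1# → x ≈ 1# ⊎ geometric p x ≈ 0#
    root-of-unity p x x^p≈1 = Sum.map₁ (x∙y⁻¹≈ε⇒x≈y x 1#) (no-zero-divisors (x - 1#) Φ (begin
      (x - 1#) * Φ   ≈⟨ [y-z]x≈yx-zx Φ x 1# ⟩
      x * Φ - 1# * Φ ≈⟨ +-cong xΦ≈Φ (-‿cong (*-identityˡ Φ)) ⟩
      Φ - Φ          ≈⟨ -‿inverseʳ Φ ⟩
      0#             ∎))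
      where
      Φ : Carrier
      Φ = geometric p x
      xΦ≈Φ : x * Φ ≈ Φ
      xΦ≈Φ = +-cancelʳ 1# (x * Φ) Φ (begin
        x * Φ + 1#   ≈⟨ telescope p x ⟩
        x ^ p + Φ    ≈⟨ +-congʳ x^p≈1 ⟩
        1# + Φ       ≈⟨ +-comm 1# Φ ⟩
        Φ + 1#       ∎)

    order-chain : ∀ u p ℓ x → x ^ (u ℕ.* p ℕ.^ ℓ) ≈ 1# →
                  x ^ u ≈ 1# ⊎ ∃ λ j → j ℕ.< ℓ × geometric p (x ^ (u ℕ.* p ℕ.^ j)) ≈ 0#
    order-chain u p zero    x x^u≈1 = inj₁ (trans (^-congʳ x (≡.sym (ℕP.*-identityʳ u))) x^u≈1)
    order-chain u p (suc ℓ) x x^up^[1+ℓ]≈1 =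
      Sum.[ Sum.map₂ weaken ∘ order-chain u p ℓ x , (λ Φ≈0 → inj₂ (ℓ , ℕP.n<1+n ℓ , Φ≈0)) ]′
        (root-of-unity p (x ^ (u ℕ.* p ℕ.^ ℓ)) (trans (^-assocʳ x (u ℕ.* p ℕ.^ ℓ) p)
          (trans (^-congʳ x (exponent u p ℓ)) x^up^[1+ℓ]≈1)))
      where
      weaken : (∃ λ j → j ℕ.< ℓ × geometric p (x ^ (u ℕ.* p ℕ.^ j)) ≈ 0#) →
               ∃ λ j → j ℕ.< suc ℓ × geometric p (x ^ (u ℕ.* p ℕ.^ j)) ≈ 0#
      weaken (j , j<ℓ , Φ≈0) = j , ℕP.m<n⇒m<1+n j<ℓ , Φ≈0
      exponent : ∀ u p ℓ → u ℕ.* p ℕ.^ ℓ ℕ.* p ≡ u ℕ.* p ℕ.^ suc ℓ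
      exponent u p ℓ = ≡.trans (ℕP.*-assoc u (p ℕ.^ ℓ) p) (cong (u ℕ.*_) (ℕP.*-comm (p ℕ.^ ℓ) p))

-- Lists of distinct natural numbers

range : ℕ → ℕ → List ℕ
range a m = applyUpTo (a ℕ.+_) m

∈-range⁻ : ∀ {a m x} → x ∈ range a m → a ℕ.≤ x × x ℕ.< a ℕ.+ m
∈-range⁻ {a} x∈range with i , i<m , ≡.refl ← ∈-applyUpTo⁻ (a ℕ.+_) x∈range =
  ℕP.m≤m+n a i , ℕP.+-monoʳ-< a i<m

∈-range⁺ : ∀ {a m x} → a ℕ.≤ x → x ℕ.< a ℕ.+ m → x ∈ range a m
∈-range⁺ {a} {m} {x} a≤x x<a+m = subst (_∈ range a m) (ℕP.m+[n∸m]≡n a≤x)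
  (∈-applyUpTo⁺ (a ℕ.+_) (ℕP.+-cancelˡ-< a _ _ (subst (ℕ._< a ℕ.+ m) (≡.sym (ℕP.m+[n∸m]≡n a≤x)) x<a+m)))

range-unique : ∀ a m → Unique (range a m)
range-unique a m = applyUpTo⁺₁ (a ℕ.+_) m (λ i<j _ → ℕP.<⇒≢ (ℕP.+-monoʳ-< a i<j))

remove : ℕ → List ℕ → List ℕ
remove a = filter (λ y → ¬? (y ≟ a))

↭-remove : ∀ {a xs} → Unique xs → a ∈ xs → xs ↭ a ∷ remove a xs
↭-remove {a} {a ∷ ys} (a∉ys ∷ _) (here ≡.refl) = ↭-prep a (↭-reflexive (≡.sym (begin
  remove a (a ∷ ys)  ≡⟨ filter-reject (λ y → ¬? (y ≟ a)) (λ a≢a → a≢a ≡.refl) ⟩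
  remove a ys        ≡⟨ filter-all (λ y → ¬? (y ≟ a)) (All.map (λ a≢y → a≢y ∘ ≡.sym) a∉ys) ⟩
  ys                 ∎)))
  where open ≡-Reasoning
↭-remove {a} {b ∷ ys} (b∉ys ∷ ys-unique) (there a∈ys) = begin
  b ∷ ys                    ↭⟨ ↭-prep b (↭-remove ys-unique a∈ys) ⟩
  b ∷ a ∷ remove a ys       ↭⟨ ↭-swap b a ↭-refl ⟩
  a ∷ b ∷ remove a ys       ≡⟨ cong (a ∷_) (filter-accept (λ y → ¬? (y ≟ a)) (All.lookup b∉ys a∈ys)) ⟨
  a ∷ remove a (b ∷ ys)     ∎
  where open PermutationReasoning

open import Data.Integer as ℤ using (ℤ; +_; _+_; _-_; -_)
import Data.Integer.Properties as ℤ
open import Data.Integer.Divisibility.Signed as Signed using (divides; ∣ᵤ⇒∣; ∣⇒∣ᵤ)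
open import Data.Integer.DivMod using (_%ℕ_; _/ℕ_; a≡a%ℕn+[a/ℕn]*n; n%ℕd<d)
open import Data.Integer.Tactic.RingSolver using (solve-∀)
open import Data.Product.Relation.Binary.Pointwise.NonDependent using (Pointwise; ×-isEquivalence)

module Mod (n : ℕ) where

  open import Data.Integer using (_*_)

  -- A record rather than _≡ℤ[ n ]_ itself, so that both sides can be inferred by unification.
  infix 4 _≈_
  record _≈_ (x y : ℤ) : Set where
    constructor mod
    field n∣x-y : + n Signed.∣ (x - y)

  ≈⇒≡ℤ : ∀ {x y} → x ≈ y → x ≡ℤ[ n ] y
  ≈⇒≡ℤ (mod n∣x-y) = ∣⇒∣ᵤ n∣x-y

  ≡ℤ⇒≈ : ∀ {x y} → x ≡ℤ[ n ] y → x ≈ y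
  ≡ℤ⇒≈ x≡y = mod (∣ᵤ⇒∣ x≡y)

  private
    mod-by : ∀ x y {e} → e ≡ x - y → + n Signed.∣ e → x ≈ y
    mod-by x y ≡.refl n∣e = mod n∣e

  ≈-isEquivalence : IsEquivalence _≈_
  ≈-isEquivalence = record
    { refl  = λ {x} → mod-by x x (≡.sym (ℤ.+-inverseʳ x)) (divides (+ 0) ≡.refl)
    ; sym   = λ { {x} {y} (mod n∣x-y) → mod-by y x (negate x y) (Signed.∣m⇒∣-m n∣x-y) }
    ; trans = λ { {x} {y} {z} (mod n∣x-y) (mod n∣y-z) →
                  mod-by x z (telescope x y z) (Signed.∣m∣n⇒∣m+n n∣x-y n∣y-z) } }
    where
    negate : ∀ x y → - (x - y) ≡ y - x
    negate = solve-∀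
    telescope : ∀ x y z → (x - y) + (y - z) ≡ x - z
    telescope = solve-∀

  +-cong : Congruent₂ _≈_ _+_
  +-cong {a} {b} {c} {d} (mod n∣a-b) (mod n∣c-d) =
    mod-by (a + c) (b + d) (regroup a b c d) (Signed.∣m∣n⇒∣m+n n∣a-b n∣c-d)
    where
    regroup : ∀ a b c d → (a - b) + (c - d) ≡ (a + c) - (b + d)
    regroup = solve-∀

  *-cong : Congruent₂ _≈_ _*_
  *-cong {a} {b} {c} {d} (mod n∣a-b) (mod n∣c-d) = mod-by (a * c) (b * d) (regroup a b c d)
    (Signed.∣m∣n⇒∣m+n (Signed.∣m⇒∣m*n c n∣a-b) (Signed.∣n⇒∣m*n b n∣c-d))
    where
    regroup : ∀ a b c d → (a - b) * c + b * (c - d) ≡ a * c - b * d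
    regroup = solve-∀

  -‿cong : Congruent₁ _≈_ (λ x → - x)
  -‿cong {a} {b} (mod n∣a-b) = mod-by (- a) (- b) (regroup a b) (Signed.∣m⇒∣-m n∣a-b)
    where
    regroup : ∀ a b → - (a - b) ≡ - a - - b
    regroup = solve-∀

  ℤ-mod : CommutativeRing 0ℓ 0ℓ
  ℤ-mod = record
    { Carrier = ℤ
    ; _≈_ = _≈_
    ; _+_ = _+_
    ; _*_ = _*_
    ; -_ = ℤ.-_
    ; 0# = + 0
    ; 1# = + 1
    ; isCommutativeRing = isCommutativeRing-coarsen ℤ.+-*-isCommutativeRing
                            ≈-isEquivalence +-cong *-cong -‿cong }

  IsSquare : ℤ → Set
  IsSquare δ = ∃ λ y → y * y ≈ δ

  ≈0⇒∣ : ∀ {x} → x ≈ + 0 → n ∣ ℤ.∣ x ∣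
  ≈0⇒∣ {x} x≈0 = subst (λ t → n ∣ ℤ.∣ t ∣) (ℤ.+-identityʳ x) (≈⇒≡ℤ x≈0)

  ∣⇒≈0 : ∀ {x} → n ∣ ℤ.∣ x ∣ → x ≈ + 0
  ∣⇒≈0 {x} n∣x = ≡ℤ⇒≈ (subst (λ t → n ∣ ℤ.∣ t ∣) (≡.sym (ℤ.+-identityʳ x)) n∣x)

  open CommutativeRing ℤ-mod public
    using (setoid; refl; sym; trans; reflexive; +-congˡ; *-congˡ; *-congʳ)
  open import Algebra.Properties.Ring (CommutativeRing.ring ℤ-mod) public
    using (x[y-z]≈xy-xz; x≈y⇒x∙y⁻¹≈ε; x∙y⁻¹≈ε⇒x≈y)
  open import Algebra.Properties.Semiring.Exp (CommutativeRing.semiring ℤ-mod) public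
    using (_^_; ^-congˡ; ^-congʳ)

  module _ .{{_ : ℕ.NonZero n}} where

    ≈-%ℕ : ∀ a → a ≈ + (a %ℕ n)
    ≈-%ℕ a = mod (divides (a /ℕ n)
      (≡.trans (cong (_- r) (a≡a%ℕn+[a/ℕn]*n a n)) (r+m-r≡m r (a /ℕ n * + n))))
      where
      r : ℤ
      r = + (a %ℕ n)
      r+m-r≡m : ∀ r m → r + m - r ≡ m
      r+m-r≡m = solve-∀

    multiple<n⇒≡0 : ∀ {m} → n ∣ m → m ℕ.< n → m ≡ 0
    multiple<n⇒≡0 {zero}  _   _   = ≡.refl
    multiple<n⇒≡0 {suc m} n∣m m<n = contradiction n∣m (>⇒∤ m<n)

    residue-unique-≤ : ∀ {r s} → s ℕ.≤ r → r ℕ.< n → + r ≈ + s → s ≡ r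
    residue-unique-≤ {r} {s} s≤r r<n r≈s = ℕP.≤-antisym s≤r (ℕP.m∸n≡0⇒m≤n r∸s≡0)
      where
      ∣r-s∣≡r∸s : ℤ.∣ + r - + s ∣ ≡ r ∸ s
      ∣r-s∣≡r∸s = cong ℤ.∣_∣ (≡.trans (ℤ.[+m]-[+n]≡m⊖n r s) (ℤ.⊖-≥ s≤r))
      r∸s≡0 : r ∸ s ≡ 0
      r∸s≡0 = multiple<n⇒≡0 (subst (n ∣_) ∣r-s∣≡r∸s (≈⇒≡ℤ r≈s)) (ℕP.≤-<-trans (ℕP.m∸n≤m r s) r<n)

    residue-unique : ∀ {r s} → r ℕ.< n → s ℕ.< n → + r ≈ + s → r ≡ s
    residue-unique {r} {s} r<n s<n r≈s with ℕP.≤-total s r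
    ... | inj₁ s≤r = ≡.sym (residue-unique-≤ s≤r r<n r≈s)
    ... | inj₂ r≤s = residue-unique-≤ r≤s s<n (sym r≈s)

    ≈0⇒%ℕ≡0 : ∀ {a} → a ≈ + 0 → a %ℕ n ≡ 0
    ≈0⇒%ℕ≡0 {a} a≈0 = residue-unique (n%ℕd<d a n) (ℕ.>-nonZero⁻¹ n) (trans (sym (≈-%ℕ a)) a≈0)

    ≈0? : ∀ a → Dec (a ≈ + 0)
    ≈0? a = map′ (λ r≡0 → trans (≈-%ℕ a) (reflexive (cong +_ r≡0))) ≈0⇒%ℕ≡0 (a %ℕ n ≟ 0)

module Pairing (n : ℕ) (σ : ℕ → ℕ) (δ : ℤ) where

  open import Data.Integer using (_*_)
  open Mod n
  open import Relation.Binary.Reasoning.Setoid setoid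

  record IsPairing (L : List ℕ) : Set where
    field
      unique        : Unique L
      closed        : ∀ {x} → x ∈ L → σ x ∈ L
      fixpoint-free : ∀ {x} → x ∈ L → σ x ≢ x
      involutive    : ∀ {x} → x ∈ L → σ (σ x) ≡ x
      paired        : ∀ {x} → x ∈ L → + x * + σ x ≈ δ

  product-pairing : ∀ k {L} → length L ≡ k ℕ.+ k → IsPairing L → + product L ≈ δ ^ k
  product-pairing zero    {[]}    _ _ = refl
  product-pairing (suc k) {x ∷ L} |x∷L|≡ pairing = begin
    + (x ℕ.* product L)           ≡⟨ ℤ.pos-* x (product L) ⟩
    + x * + product L             ≡⟨ cong (λ m → + x * + m) (product-↭ L↭σx∷L′) ⟩
    + x * + (σ x ℕ.* product L′)  ≡⟨ cong (+ x *_) (ℤ.pos-* (σ x) (product L′)) ⟩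
    + x * (+ σ x * + product L′)  ≡⟨ ℤ.*-assoc (+ x) (+ σ x) (+ product L′) ⟨
    + x * + σ x * + product L′    ≈⟨ *-cong (paired (here ≡.refl)) (product-pairing k |L′|≡ pairing′) ⟩
    δ * δ ^ k                     ∎
    where
    open IsPairing pairing

    L-unique : Unique L
    L-unique with _ ∷ L-unique ← unique = L-unique

    x∉L : x ∉ L
    x∉L = Unique[x∷xs]⇒x∉xs unique

    σx∈L : σ x ∈ L
    σx∈L with closed (here ≡.refl)
    ... | here σx≡x  = contradiction σx≡x (fixpoint-free (here ≡.refl))
    ... | there σx∈L = σx∈L

    L′ : List ℕ
    L′ = remove (σ x) L

    L↭σx∷L′ : L ↭ σ x ∷ L′
    L↭σx∷L′ = ↭-remove L-unique σx∈L

    |L′|≡ : length L′ ≡ k ℕ.+ k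
    |L′|≡ = ℕP.suc-injective (ℕP.suc-injective
      (≡.trans (cong suc (≡.sym (↭-length L↭σx∷L′))) (≡.trans |x∷L|≡ (cong suc (ℕP.+-suc k k)))))

    ∈L′⁻ : ∀ {y} → y ∈ L′ → y ∈ L × y ≢ σ x
    ∈L′⁻ = ∈-filter⁻ (λ y → ¬? (y ≟ σ x))

    ∈x∷L : ∀ {y} → y ∈ L′ → y ∈ x ∷ L
    ∈x∷L = there ∘ proj₁ ∘ ∈L′⁻

    pairing′ : IsPairing L′
    pairing′ = record
      { unique        = filter⁺ (λ y → ¬? (y ≟ σ x)) L-unique
      ; closed        = closed′
      ; fixpoint-free = fixpoint-free ∘ ∈x∷L
      ; involutive    = involutive ∘ ∈x∷L
      ; paired        = paired ∘ ∈x∷L }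
      where
      closed′ : ∀ {y} → y ∈ L′ → σ y ∈ L′
      closed′ {y} y∈L′ with y∈L , y≢σx ← ∈L′⁻ y∈L′ | closed (there y∈L)
      ... | here σy≡x  = contradiction (≡.trans (≡.sym (involutive (there y∈L))) (cong σ σy≡x)) y≢σx
      ... | there σy∈L = ∈-filter⁺ (λ y → ¬? (y ≟ σ x)) σy∈L σy≢σx
        where
        σy≢σx : σ y ≢ σ x
        σy≢σx σy≡σx = x∉L (subst (_∈ L) y≡x y∈L)
          where
          y≡x : y ≡ x
          y≡x = ≡.trans (≡.sym (involutive (there y∈L)))
                  (≡.trans (cong σ σy≡σx) (involutive (here ≡.refl)))

module PrimeModulus (N : ℕ) (N-prime : Prime N) where

  open import Data.Integer using (_*_)

  open Mod N public
  open import Relation.Binary.Reasoning.Setoid setoid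

  instance
    N≢0 : ℕ.NonZero N
    N≢0 = prime⇒nonZero N-prime

  euclid : ∀ a b → a * b ≈ + 0 → a ≈ + 0 ⊎ b ≈ + 0
  euclid a b ab≈0 = Sum.map ∣⇒≈0 ∣⇒≈0
    (euclidsLemma ℤ.∣ a ∣ ℤ.∣ b ∣ N-prime (subst (N ∣_) (ℤ.abs-* a b) (≈0⇒∣ ab≈0)))

  *-cancelˡ : ∀ {a b c} → ¬ a ≈ + 0 → a * b ≈ a * c → b ≈ c
  *-cancelˡ {a} {b} {c} a≉0 ab≈ac =
    x∙y⁻¹≈ε⇒x≈y b c (Sum.[ flip contradiction a≉0 , id ] (euclid a (b - c) a[b-c]≈0))
    where
    a[b-c]≈0 : a * (b - c) ≈ + 0
    a[b-c]≈0 = trans (x[y-z]≈xy-xz a b c) (x≈y⇒x∙y⁻¹≈ε ab≈ac)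

  N≈0 : + N ≈ + 0
  N≈0 = mod (divides (+ 1) (x-0≡1*x (+ N)))
    where
    x-0≡1*x : ∀ x → x - + 0 ≡ + 1 * x
    x-0≡1*x = solve-∀

  1^k≈1 : ∀ k → (+ 1) ^ k ≈ + 1
  1^k≈1 zero    = refl
  1^k≈1 (suc k) = trans (reflexive (ℤ.*-identityˡ _)) (1^k≈1 k)

  fermat : ∀ a → a ^ N ≈ a
  fermat a = begin
    a ^ N          ≈⟨ ^-congˡ N (≈-%ℕ a) ⟩
    (+ r) ^ N      ≈⟨ fermat-ℕ r ⟩
    + r            ≈⟨ sym (≈-%ℕ a) ⟩
    a              ∎
    where
    r : ℕ
    r = a %ℕ N
    module Mult = Algebra.Properties.Semiring.Mult (CommutativeRing.semiring ℤ-mod)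

    ×1≡ : ∀ k → k Mult.× + 1 ≡ + k
    ×1≡ zero    = ≡.refl
    ×1≡ (suc k) = cong (ℤ.suc) (×1≡ k)

    fermat-ℕ : ∀ m → (+ m) ^ N ≈ + m
    fermat-ℕ zero    = ^-congʳ (+ 0) (≡.sym (ℕP.suc-pred N))
    fermat-ℕ (suc m) = begin
      (+ 1 + + m) ^ N    ≈⟨ freshmansDream (CommutativeRing.commutativeSemiring ℤ-mod)
                              N-prime (trans (reflexive (×1≡ N)) N≈0) (+ 1) (+ m) ⟩
      (+ 1) ^ N + (+ m) ^ N ≈⟨ +-cong (1^k≈1 N) (fermat-ℕ m) ⟩
      + 1 + + m          ∎

  fermat-inverse : ∀ {a} → ¬ a ≈ + 0 → a * a ^ (N ∸ 2) ≈ + 1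
  fermat-inverse {a} a≉0 = *-cancelˡ a≉0 (begin
    a * (a * a ^ (N ∸ 2))  ≈⟨ ^-congʳ a (ℕP.m+[n∸m]≡n (prime≥2 N-prime)) ⟩
    a ^ N                  ≈⟨ fermat a ⟩
    a                      ≡⟨ ℤ.*-identityʳ a ⟨
    a * + 1                ∎)

  ¬square-scale : ∀ {δ c} → ¬ IsSquare δ → ¬ c ≈ + 0 → ¬ IsSquare (c * c * δ)
  ¬square-scale {δ} {c} δ-nonsquare c≉0 (y , y²≈c²δ) = δ-nonsquare (y * c⁻¹ , (begin
    y * c⁻¹ * (y * c⁻¹)          ≡⟨ regroup₁ y c⁻¹ ⟩
    y * y * (c⁻¹ * c⁻¹)          ≈⟨ *-congʳ y²≈c²δ ⟩
    c * c * δ * (c⁻¹ * c⁻¹)      ≡⟨ regroup₂ c δ c⁻¹ ⟩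
    (c * c⁻¹) * (c * c⁻¹) * δ    ≈⟨ *-congʳ (*-cong c*c⁻¹≈1 c*c⁻¹≈1) ⟩
    + 1 * + 1 * δ                ≡⟨ ℤ.*-identityˡ δ ⟩
    δ                            ∎))
    where
    c⁻¹ : ℤ
    c⁻¹ = c ^ (N ∸ 2)
    c*c⁻¹≈1 : c * c⁻¹ ≈ + 1
    c*c⁻¹≈1 = fermat-inverse c≉0
    regroup₁ : ∀ y z → y * z * (y * z) ≡ y * y * (z * z)
    regroup₁ = solve-∀
    regroup₂ : ∀ c δ z → c * c * δ * (z * z) ≡ (c * z) * (c * z) * δ
    regroup₂ = solve-∀

  unit-residue : ∀ {x} → 0 ℕ.< x → x ℕ.< N → ¬ + x ≈ + 0
  unit-residue x>0 x<N x≈0 = ℕP.<⇒≢ x>0 (≡.sym (residue-unique x<N (ℕP.≤-<-trans z≤n (prime≥2 N-prime)) x≈0))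

  N-1≈-1 : + (N ∸ 1) ≈ - + 1
  N-1≈-1 = mod (divides (+ 1)
    (≡.trans (cong +_ (ℕP.m∸n+n≡m (ℕP.<⇒≤ (prime≥2 N-prime)))) (≡.sym (ℤ.*-identityˡ (+ N)))))

  square-roots-of-1 : ∀ {a} → a * a ≈ + 1 → a ≈ + 1 ⊎ a ≈ - + 1
  square-roots-of-1 {a} a²≈1 = Sum.map (x∙y⁻¹≈ε⇒x≈y a (+ 1)) (x∙y⁻¹≈ε⇒x≈y a (- + 1))
    (euclid (a - + 1) (a + + 1) (begin
      (a - + 1) * (a + + 1)  ≡⟨ difference-of-squares a ⟩
      a * a - + 1            ≈⟨ x≈y⇒x∙y⁻¹≈ε a²≈1 ⟩
      + 0                    ∎))
    where
    difference-of-squares : ∀ a → (a - + 1) * (a + + 1) ≡ a * a - + 1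
    difference-of-squares = solve-∀


module QuadraticResidues (N : ℕ) (N-prime : Prime N) where

  open import Data.Integer using (_*_)
  open PrimeModulus N N-prime
  open import Relation.Binary.Reasoning.Setoid setoid

  -- The residue of δ / x, computed as δ · x ^ (N ∸ 2) by Fermat's little theorem.
  partner : ℤ → ℕ → ℕ
  partner δ x = (δ * (+ x) ^ (N ∸ 2)) %ℕ N

  partner<N : ∀ δ x → partner δ x ℕ.< N
  partner<N δ x = n%ℕd<d (δ * (+ x) ^ (N ∸ 2)) N

  partner-paired : ∀ δ {x} → ¬ + x ≈ + 0 → + x * + partner δ x ≈ δ
  partner-paired δ {x} x≉0 = begin
    + x * + partner δ x          ≈⟨ *-congˡ {+ x} (sym (≈-%ℕ (δ * x⁻¹))) ⟩
    + x * (δ * x⁻¹)              ≡⟨ regroup (+ x) δ x⁻¹ ⟩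
    δ * (+ x * x⁻¹)              ≈⟨ *-congˡ {δ} (fermat-inverse x≉0) ⟩
    δ * + 1                      ≡⟨ ℤ.*-identityʳ δ ⟩
    δ                            ∎
    where
    x⁻¹ : ℤ
    x⁻¹ = (+ x) ^ (N ∸ 2)
    regroup : ∀ x δ y → x * (δ * y) ≡ δ * (x * y)
    regroup = solve-∀

  partner-pos : ∀ {δ x} → ¬ δ ≈ + 0 → ¬ + x ≈ + 0 → 0 ℕ.< partner δ x
  partner-pos {δ} {x} δ≉0 x≉0 = ℕP.n≢0⇒n>0 λ y≡0 → δ≉0 (begin
    δ                    ≈⟨ sym (partner-paired δ x≉0) ⟩
    + x * + partner δ x  ≡⟨ cong (λ t → + x * + t) y≡0 ⟩
    + x * + 0            ≡⟨ ℤ.*-zeroʳ (+ x) ⟩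
    + 0                  ∎)

  partner-involutive : ∀ {δ x} → ¬ δ ≈ + 0 → 0 ℕ.< x → x ℕ.< N → partner δ (partner δ x) ≡ x
  partner-involutive {δ} {x} δ≉0 x>0 x<N = residue-unique (partner<N δ y) x<N (*-cancelˡ y≉0 (begin
    + y * + partner δ y  ≈⟨ partner-paired δ y≉0 ⟩
    δ                    ≈⟨ sym (partner-paired δ x≉0) ⟩
    + x * + y            ≡⟨ ℤ.*-comm (+ x) (+ y) ⟩
    + y * + x            ∎))
    where
    y : ℕ
    y = partner δ x
    x≉0 : ¬ + x ≈ + 0
    x≉0 = unit-residue x>0 x<N
    y≉0 : ¬ + y ≈ + 0
    y≉0 = unit-residue (partner-pos δ≉0 x≉0) (partner<N δ x)

  range-bounds : ∀ {a m x} → 0 ℕ.< a → a ℕ.+ m ℕ.≤ N → x ∈ range a m → 0 ℕ.< x × x ℕ.< N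
  range-bounds a>0 a+m≤N x∈range with a≤x , x<a+m ← ∈-range⁻ x∈range =
    ℕP.<-≤-trans a>0 a≤x , ℕP.<-≤-trans x<a+m a+m≤N

  -- 1 and N ∸ 1 are the only units equal to their own inverse, so the others pair up.
  inverse-pairing : ∀ {m} → N ≡ 3 ℕ.+ (m ℕ.+ m) → Pairing.IsPairing N (partner (+ 1)) (+ 1) (range 2 (m ℕ.+ m))
  inverse-pairing {m} N≡3+n = record
    { unique        = range-unique 2 n
    ; closed        = closed
    ; fixpoint-free = λ {x} x∈range y≡x → Sum.[ x≉1 x∈range , x≉-1 x∈range ]
        (square-roots-of-1 (subst (λ t → + x * + t ≈ + 1) y≡x (partner-paired (+ 1) (x≉0 x∈range))))
    ; involutive    = λ x∈range → partner-involutive 1≉0 (proj₁ (bounds x∈range)) (proj₂ (bounds x∈range))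
    ; paired        = partner-paired (+ 1) ∘ x≉0 }
    where
    n : ℕ
    n = m ℕ.+ m
    1≉0 : ¬ + 1 ≈ + 0
    1≉0 = unit-residue (s≤s z≤n) (prime≥2 N-prime)

    2+n≈-1 : + (2 ℕ.+ n) ≈ - + 1
    2+n≈-1 = subst (λ t → + (t ∸ 1) ≈ - + 1) N≡3+n N-1≈-1

    bounds : ∀ {x} → x ∈ range 2 n → 0 ℕ.< x × x ℕ.< N
    bounds = range-bounds (s≤s z≤n) (ℕP.≤-trans (ℕP.n≤1+n (2 ℕ.+ n)) (ℕP.≤-reflexive (≡.sym N≡3+n)))

    x≉0 : ∀ {x} → x ∈ range 2 n → ¬ + x ≈ + 0
    x≉0 x∈range = unit-residue (proj₁ (bounds x∈range)) (proj₂ (bounds x∈range))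

    x≉1 : ∀ {x} → x ∈ range 2 n → ¬ + x ≈ + 1
    x≉1 x∈range x≈1 = ℕP.<⇒≢ (proj₁ (∈-range⁻ x∈range))
      (≡.sym (residue-unique (proj₂ (bounds x∈range)) (prime≥2 N-prime) x≈1))

    x≉-1 : ∀ {x} → x ∈ range 2 n → ¬ + x ≈ - + 1
    x≉-1 x∈range x≈-1 = ℕP.<⇒≢ (proj₂ (∈-range⁻ x∈range))
      (residue-unique (proj₂ (bounds x∈range)) (subst (2 ℕ.+ n ℕ.<_) (≡.sym N≡3+n) ℕP.≤-refl)
        (trans x≈-1 (sym 2+n≈-1)))

    inverse-of-−1 : ∀ {x y} → + x * + y ≈ + 1 → + y ≈ - + 1 → + x ≈ - + 1
    inverse-of-−1 {x} {y} xy≈1 y≈-1 = begin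
      + x                  ≡⟨ double-negation (+ x) ⟩
      - (+ x * - + 1)      ≈⟨ -‿cong (*-congˡ {+ x} (sym y≈-1)) ⟩
      - (+ x * + y)        ≈⟨ -‿cong xy≈1 ⟩
      - + 1                ∎
      where
      double-negation : ∀ x → x ≡ - (x * - + 1)
      double-negation = solve-∀

    closed : ∀ {x} → x ∈ range 2 n → partner (+ 1) x ∈ range 2 n
    closed {x} x∈range = ∈-range⁺ (ℕP.≤∧≢⇒< y>0 1≢y) (ℕP.≤∧≢⇒< (ℕP.≤-pred y<3+n) y≢2+n)
      where
      y : ℕ
      y = partner (+ 1) x
      y>0 : 0 ℕ.< y
      y>0 = partner-pos 1≉0 (x≉0 x∈range)
      y<3+n : y ℕ.< 3 ℕ.+ n
      y<3+n = subst (y ℕ.<_) N≡3+n (partner<N (+ 1) x)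
      xy≈1 : + x * + y ≈ + 1
      xy≈1 = partner-paired (+ 1) (x≉0 x∈range)
      1≢y : 1 ≢ y
      1≢y 1≡y = x≉1 x∈range (trans (reflexive (≡.sym (ℤ.*-identityʳ (+ x))))
        (subst (λ t → + x * + t ≈ + 1) (≡.sym 1≡y) xy≈1))
      y≢2+n : y ≢ 2 ℕ.+ n
      y≢2+n y≡2+n = x≉-1 x∈range (inverse-of-−1 xy≈1 (subst (λ t → + t ≈ - + 1) (≡.sym y≡2+n) 2+n≈-1))

  wilson : ∀ {m} → N ≡ 3 ℕ.+ (m ℕ.+ m) → + product (range 1 (2 ℕ.+ (m ℕ.+ m))) ≈ - + 1
  wilson {m} N≡3+n = begin
    + product (range 1 (2 ℕ.+ n))           ≡⟨ cong +_ peel-ends ⟩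
    + (product (range 2 n) ℕ.* (2 ℕ.+ n))   ≡⟨ ℤ.pos-* (product (range 2 n)) (2 ℕ.+ n) ⟩
    + product (range 2 n) * + (2 ℕ.+ n)     ≈⟨ *-cong inner-product 2+n≈-1 ⟩
    + 1 * - + 1                             ≡⟨ ℤ.*-identityˡ (- + 1) ⟩
    - + 1                                   ∎
    where
    n : ℕ
    n = m ℕ.+ m

    peel-ends : product (range 1 (2 ℕ.+ n)) ≡ product (range 2 n) ℕ.* (2 ℕ.+ n)
    peel-ends = ≡.trans (ℕP.*-identityˡ (product (range 2 (suc n))))
      (≡.trans (cong product (≡.sym (applyUpTo-∷ʳ (2 ℕ.+_) n)))
      (≡.trans (product-++ (range 2 n) (2 ℕ.+ n ∷ []))
        (cong (product (range 2 n) ℕ.*_) (ℕP.*-identityʳ (2 ℕ.+ n)))))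

    inner-product : + product (range 2 n) ≈ + 1
    inner-product = trans (Pairing.product-pairing N (partner (+ 1)) (+ 1) m
      (length-applyUpTo (2 ℕ.+_) n) (inverse-pairing {m} N≡3+n)) (1^k≈1 m)

    2+n≈-1 : + (2 ℕ.+ n) ≈ - + 1
    2+n≈-1 = subst (λ t → + (t ∸ 1) ≈ - + 1) N≡3+n N-1≈-1

  quotient-pairing : ∀ {δ} → ¬ IsSquare δ → Pairing.IsPairing N (partner δ) δ (range 1 (N ∸ 1))
  quotient-pairing {δ} δ-nonsquare = record
    { unique        = range-unique 1 (N ∸ 1)
    ; closed        = λ {x} x∈units → ∈-range⁺ (partner-pos δ≉0 (x≉0 x∈units))
        (ℕP.<-≤-trans (partner<N δ x) (ℕP.≤-reflexive (≡.sym 1+[N-1]≡N)))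
    ; fixpoint-free = λ {x} x∈units y≡x →
        δ-nonsquare (+ x , subst (λ t → + x * + t ≈ δ) y≡x (partner-paired δ (x≉0 x∈units)))
    ; involutive    = λ x∈units → partner-involutive δ≉0 (proj₁ (bounds x∈units)) (proj₂ (bounds x∈units))
    ; paired        = partner-paired δ ∘ x≉0 }
    where
    1+[N-1]≡N : 1 ℕ.+ (N ∸ 1) ≡ N
    1+[N-1]≡N = ℕP.m+[n∸m]≡n (ℕP.<⇒≤ (prime≥2 N-prime))

    bounds : ∀ {x} → x ∈ range 1 (N ∸ 1) → 0 ℕ.< x × x ℕ.< N
    bounds = range-bounds (s≤s z≤n) (ℕP.≤-reflexive 1+[N-1]≡N)

    x≉0 : ∀ {x} → x ∈ range 1 (N ∸ 1) → ¬ + x ≈ + 0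
    x≉0 x∈units = unit-residue (proj₁ (bounds x∈units)) (proj₂ (bounds x∈units))

    δ≉0 : ¬ δ ≈ + 0
    δ≉0 δ≈0 = δ-nonsquare (+ 0 , sym δ≈0)

  euler-criterion : ∀ {k δ} → N ≡ suc (k ℕ.+ k) → ¬ IsSquare δ → δ ^ k ≈ - + 1
  euler-criterion {zero}  N≡1 _ = contradiction (≡.subst (2 ℕ.≤_) N≡1 (prime≥2 N-prime)) λ { (s≤s ()) }
  euler-criterion {suc m} {δ} N≡1+2k δ-nonsquare = begin
    δ ^ suc m                              ≈⟨ sym (Pairing.product-pairing N (partner δ) δ (suc m)
                                                 |units|≡ (quotient-pairing δ-nonsquare)) ⟩
    + product (range 1 (N ∸ 1))            ≡⟨ cong (λ t → + product (range 1 t)) N-1≡2+2m ⟩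
    + product (range 1 (2 ℕ.+ (m ℕ.+ m)))  ≈⟨ wilson {m} (≡.trans N≡1+2k (cong (2 ℕ.+_) (ℕP.+-suc m m))) ⟩
    - + 1                                  ∎
    where
    N-1≡2+2m : N ∸ 1 ≡ 2 ℕ.+ (m ℕ.+ m)
    N-1≡2+2m = ≡.trans (cong (_∸ 1) N≡1+2k) (cong suc (ℕP.+-suc m m))

    |units|≡ : length (range 1 (N ∸ 1)) ≡ suc m ℕ.+ suc m
    |units|≡ = ≡.trans (length-applyUpTo (1 ℕ.+_) (N ∸ 1)) (cong (_∸ 1) N≡1+2k)

-- ℤ[ω] for ω² = t ω + s; the pair (a , b) stands for a + b ω.
module Quadratic (t s : ℤ) where

  open import Data.Integer using (_*_)

  infixl 7 _·_
  _·_ : Elt → Elt → Elt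
  (a , b) · (c , d) = (a * c + b * d * s , a * d + b * c + b * d * t)

  neg : Elt → Elt
  neg (a , b) = (- a , - b)

  ι : ℤ → Elt
  ι a = (a , + 0)

  ω : Elt
  ω = (+ 0 , + 1)

  conj : Elt → Elt
  conj (a , b) = (a + b * t , - b)

  normQ : Elt → ℤ
  normQ (a , b) = a * a + t * a * b - s * b * b

  ·-isCommutativeRing : IsCommutativeRing _≡_ add _·_ neg zeroE one
  ·-isCommutativeRing = record
    { isRing = record
      { +-isAbelianGroup = record
        { isGroup = record
          { isMonoid = record
            { isSemigroup = record
              { isMagma = record { isEquivalence = ≡.isEquivalence ; ∙-cong = cong₂ add }
              ; assoc = λ { (a , b) (c , d) (e , f) → cong₂ _,_ (ℤ.+-assoc a c e) (ℤ.+-assoc b d f) } }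
            ; identity = (λ { (a , b) → cong₂ _,_ (ℤ.+-identityˡ a) (ℤ.+-identityˡ b) })
                       , (λ { (a , b) → cong₂ _,_ (ℤ.+-identityʳ a) (ℤ.+-identityʳ b) }) }
          ; inverse = (λ { (a , b) → cong₂ _,_ (ℤ.+-inverseˡ a) (ℤ.+-inverseˡ b) })
                    , (λ { (a , b) → cong₂ _,_ (ℤ.+-inverseʳ a) (ℤ.+-inverseʳ b) })
          ; ⁻¹-cong = cong neg }
        ; comm = λ { (a , b) (c , d) → cong₂ _,_ (ℤ.+-comm a c) (ℤ.+-comm b d) } }
      ; *-cong = cong₂ _·_
      ; *-assoc = λ { (a , b) (c , d) (e , f) →
          cong₂ _,_ (assoc₁ t s a b c d e f) (assoc₂ t s a b c d e f) }
      ; *-identity = ·-identityˡ , λ x → ≡.trans (·-comm x one) (·-identityˡ x)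
      ; distrib = ·-distribˡ , λ x y z → ≡.trans (·-comm (add y z) x)
          (≡.trans (·-distribˡ x y z) (cong₂ add (·-comm x y) (·-comm x z))) }
    ; *-comm = ·-comm }
    where
    ·-comm : ∀ x y → x · y ≡ y · x
    ·-comm (a , b) (c , d) = cong₂ _,_ (comm₁ s a b c d) (comm₂ t a b c d)
      where
      comm₁ : ∀ s a b c d → a * c + b * d * s ≡ c * a + d * b * s
      comm₁ = solve-∀
      comm₂ : ∀ t a b c d → a * d + b * c + b * d * t ≡ c * b + d * a + d * b * t
      comm₂ = solve-∀

    ·-identityˡ : ∀ x → one · x ≡ x
    ·-identityˡ (a , b) = cong₂ _,_ (identity₁ s a b) (identity₂ t a b)
      where
      identity₁ : ∀ s a b → + 1 * a + + 0 * b * s ≡ a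
      identity₁ = solve-∀
      identity₂ : ∀ t a b → + 1 * b + + 0 * a + + 0 * b * t ≡ b
      identity₂ = solve-∀

    ·-distribˡ : ∀ x y z → x · add y z ≡ add (x · y) (x · z)
    ·-distribˡ (a , b) (c , d) (e , f) = cong₂ _,_ (distrib₁ s a b c d e f) (distrib₂ t a b c d e f)
      where
      distrib₁ : ∀ s a b c d e f →
        a * (c + e) + b * (d + f) * s ≡ (a * c + b * d * s) + (a * e + b * f * s)
      distrib₁ = solve-∀
      distrib₂ : ∀ t a b c d e f →
        a * (d + f) + b * (c + e) + b * (d + f) * t ≡ (a * d + b * c + b * d * t) + (a * f + b * e + b * f * t)
      distrib₂ = solve-∀

    assoc₁ : ∀ t s a b c d e f →
      (a * c + b * d * s) * e + (a * d + b * c + b * d * t) * f * s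
        ≡ a * (c * e + d * f * s) + b * (c * f + d * e + d * f * t) * s
    assoc₁ = solve-∀
    assoc₂ : ∀ t s a b c d e f →
      (a * c + b * d * s) * f + (a * d + b * c + b * d * t) * e + (a * d + b * c + b * d * t) * f * t
        ≡ a * (c * f + d * e + d * f * t) + b * (c * e + d * f * s) + b * (c * f + d * e + d * f * t) * t
    assoc₂ = solve-∀

  Δ : ℤ
  Δ = t * t + + 4 * s

  θ : Elt
  θ = (- t , + 2)

  θ·θ≡ιΔ : θ · θ ≡ ι Δ
  θ·θ≡ιΔ = cong₂ _,_ (square₁ t s) (square₂ t)
    where
    square₁ : ∀ t s → - t * - t + + 2 * + 2 * s ≡ t * t + + 4 * s
    square₁ = solve-∀
    square₂ : ∀ t → - t * + 2 + + 2 * - t + + 2 * + 2 * t ≡ + 0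
    square₂ = solve-∀

  ι-· : ∀ a b → ι a · ι b ≡ ι (a * b)
  ι-· a b = cong₂ _,_ (product₁ t s a b) (product₂ t a b)
    where
    product₁ : ∀ t s a b → a * b + + 0 * + 0 * s ≡ a * b
    product₁ = solve-∀
    product₂ : ∀ t a b → a * + 0 + + 0 * b + + 0 * + 0 * t ≡ + 0
    product₂ = solve-∀

  ι-·ω : ∀ a b → add (ι a) (ι b · ω) ≡ (a , b)
  ι-·ω a b = cong₂ _,_ (coordinate₁ s a b) (coordinate₂ t b)
    where
    coordinate₁ : ∀ s a b → a + (b * + 0 + + 0 * + 1 * s) ≡ a
    coordinate₁ = solve-∀
    coordinate₂ : ∀ t b → + 0 + (b * + 1 + + 0 * + 0 + + 0 * + 1 * t) ≡ b
    coordinate₂ = solve-∀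

  ·-conj : ∀ x → x · conj x ≡ ι (normQ x)
  ·-conj (a , b) = cong₂ _,_ (norm₁ t s a b) (norm₂ t a b)
    where
    norm₁ : ∀ t s a b → a * (a + b * t) + b * - b * s ≡ a * a + t * a * b - s * b * b
    norm₁ = solve-∀
    norm₂ : ∀ t a b → a * - b + b * (a + b * t) + b * - b * t ≡ + 0
    norm₂ = solve-∀

  normQ-· : ∀ x y → normQ (x · y) ≡ normQ x * normQ y
  normQ-· (a , b) (c , d) = multiplicative t s a b c d
    where
    multiplicative : ∀ t s a b c d →
      let e = a * c + b * d * s ; f = a * d + b * c + b * d * t in
      e * e + t * e * f - s * f * f ≡ (a * a + t * a * b - s * b * b) * (c * c + t * c * d - s * d * d)
    multiplicative = solve-∀

  4·normQ : ∀ a b → (+ 2 * a + t * b) * (+ 2 * a + t * b) ≡ b * b * Δ + + 4 * normQ (a , b)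
  4·normQ a b = completing-the-square t s a b
    where
    completing-the-square : ∀ t s a b →
      (+ 2 * a + t * b) * (+ 2 * a + t * b) ≡ b * b * (t * t + + 4 * s) + + 4 * (a * a + t * a * b - s * b * b)
    completing-the-square = solve-∀

  module Modulo (n : ℕ) where
    open Mod n using (_≈_; ≈-isEquivalence; +-cong; *-cong; -‿cong; refl)

    infix 4 _≋_
    _≋_ : Elt → Elt → Set
    _≋_ = Pointwise _≈_ _≈_

    ℤ[ω]-mod : CommutativeRing 0ℓ 0ℓ
    ℤ[ω]-mod = record
      { isCommutativeRing = isCommutativeRing-coarsen ·-isCommutativeRing
          (×-isEquivalence ≈-isEquivalence ≈-isEquivalence) add-cong ·-cong neg-cong }
      where
      add-cong : Congruent₂ _≋_ add
      add-cong (a≈ , b≈) (c≈ , d≈) = +-cong a≈ c≈ , +-cong b≈ d≈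

      ·-cong : Congruent₂ _≋_ _·_
      ·-cong (a≈ , b≈) (c≈ , d≈) =
        +-cong (*-cong a≈ c≈) (*-cong (*-cong b≈ d≈) refl) ,
        +-cong (+-cong (*-cong a≈ d≈) (*-cong b≈ c≈)) (*-cong (*-cong b≈ d≈) refl)

      neg-cong : Congruent₁ _≋_ neg
      neg-cong (a≈ , b≈) = -‿cong a≈ , -‿cong b≈

module QuadraticModPrime (t s : ℤ) (N : ℕ) (N-prime : Prime N)
                         (Δ-nonsquare : ¬ Mod.IsSquare N (Quadratic.Δ t s)) where

  open import Data.Integer using (_*_)

  private
    module ℤₙ = PrimeModulus N N-prime
    module QR = QuadraticResidues N N-prime
  open Quadratic t s
  open Modulo N public
  open CommutativeRing ℤ[ω]-mod public
    using (setoid; refl; trans; reflexive; +-cong; *-cong; *-congˡ; *-congʳ; *-assoc; *-identityˡ)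
  open import Relation.Binary.Reasoning.Setoid setoid

  normQ-cong : ∀ {x y} → x ≋ y → normQ x ℤₙ.≈ normQ y
  normQ-cong (a≈ , b≈) =
    ℤₙ.+-cong (ℤₙ.+-cong (ℤₙ.*-cong a≈ a≈) (ℤₙ.*-cong (ℤₙ.*-cong (ℤₙ.refl {t}) a≈) b≈))
              (ℤₙ.-‿cong (ℤₙ.*-cong (ℤₙ.*-cong (ℤₙ.refl {s}) b≈) b≈))

  normQ≈0⇒≋0 : ∀ x → normQ x ℤₙ.≈ + 0 → x ≋ zeroE
  normQ≈0⇒≋0 (a , b) norm≈0 with ℤₙ.≈0? b
  ... | no b≉0 = contradiction (+ 2 * a + t * b , square) (ℤₙ.¬square-scale Δ-nonsquare b≉0)
    where
    square : (+ 2 * a + t * b) * (+ 2 * a + t * b) ℤₙ.≈ b * b * Δ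
    square = ℤₙ.trans (ℤₙ.reflexive (4·normQ a b))
      (ℤₙ.trans (ℤₙ.+-congˡ {b * b * Δ} (ℤₙ.*-congˡ {+ 4} norm≈0))
        (ℤₙ.reflexive (ℤ.+-identityʳ (b * b * Δ))))
  ... | yes b≈0 = Sum.[ id , id ]′ (ℤₙ.euclid a a a²≈0) , b≈0
    where
    a²≈0 : a * a ℤₙ.≈ + 0
    a²≈0 = ℤₙ.trans (ℤₙ.reflexive (≡.sym (norm-at-0 t s a)))
      (ℤₙ.trans (normQ-cong {a , + 0} {a , b} (ℤₙ.refl , ℤₙ.sym b≈0)) norm≈0)
      where
      norm-at-0 : ∀ t s a → a * a + t * a * + 0 - s * + 0 * + 0 ≡ a * a
      norm-at-0 = solve-∀

  no-zero-divisors : ∀ x y → x · y ≋ zeroE → x ≋ zeroE ⊎ y ≋ zeroE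
  no-zero-divisors x y xy≋0 = Sum.map (normQ≈0⇒≋0 x) (normQ≈0⇒≋0 y) (ℤₙ.euclid (normQ x) (normQ y)
    (ℤₙ.trans (ℤₙ.reflexive (≡.sym (normQ-· x y)))
      (ℤₙ.trans (normQ-cong xy≋0) (ℤₙ.reflexive (norm-0 t s)))))
    where
    norm-0 : ∀ t s → + 0 * + 0 + t * + 0 * + 0 - s * + 0 * + 0 ≡ + 0
    norm-0 = solve-∀

  open import Algebra.Properties.Semiring.Exp (CommutativeRing.semiring ℤ[ω]-mod) public
    using (_^_; ^-congˡ; ^-homo-*)
  open import Algebra.Properties.CommutativeSemiring.Exp (CommutativeRing.commutativeSemiring ℤ[ω]-mod)
    using (^-distrib-*)
  open import Algebra.Properties.Ring (CommutativeRing.ring ℤ[ω]-mod) using (+-cancelˡ)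

  ι-^ : ∀ a m → ι a ^ m ≋ ι (a ℤₙ.^ m)
  ι-^ a zero    = refl
  ι-^ a (suc m) = trans (*-congˡ {ι a} (ι-^ a m)) (reflexive (ι-· a (a ℤₙ.^ m)))

  frobenius-ι : ∀ a → ι a ^ N ≋ ι a
  frobenius-ι a = trans (ι-^ a N) (ℤₙ.fermat a , ℤₙ.refl)

  frobenius-+ : ∀ x y → add x y ^ N ≋ add (x ^ N) (y ^ N)
  frobenius-+ = freshmansDream (CommutativeRing.commutativeSemiring ℤ[ω]-mod) N-prime
    (trans (reflexive (×one≡ N)) (ℤₙ.N≈0 , ℤₙ.refl))
    where
    module Mult = Algebra.Properties.Semiring.Mult (CommutativeRing.semiring ℤ[ω]-mod)
    ×one≡ : ∀ m → m Mult.× one ≡ ι (+ m)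
    ×one≡ zero    = ≡.refl
    ×one≡ (suc m) = cong (add one) (×one≡ m)

  module Odd (k : ℕ) (N≡1+2k : N ≡ suc (k ℕ.+ k)) where

    θ^N≋-θ : θ ^ N ≋ neg θ
    θ^N≋-θ = begin
      θ ^ N                  ≡⟨ cong (θ ^_) N≡1+2k ⟩
      θ · θ ^ (k ℕ.+ k)      ≈⟨ *-congˡ {θ} (^-homo-* θ k k) ⟩
      θ · (θ ^ k · θ ^ k)    ≈⟨ *-congˡ {θ} (^-distrib-* θ θ k) ⟨
      θ · (θ · θ) ^ k        ≈⟨ *-congˡ {θ} (^-congˡ k (reflexive θ·θ≡ιΔ)) ⟩
      θ · ι Δ ^ k            ≈⟨ *-congˡ {θ} (ι-^ Δ k) ⟩
      θ · ι (Δ ℤₙ.^ k)       ≈⟨ *-congˡ {θ} (QR.euler-criterion {k} N≡1+2k Δ-nonsquare , ℤₙ.refl) ⟩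
      θ · ι (- + 1)          ≡⟨ cong₂ _,_ (negate₁ t s) (negate₂ t) ⟩
      neg θ                  ∎
      where
      negate₁ : ∀ t s → - t * - + 1 + + 2 * + 0 * s ≡ - - t
      negate₁ = solve-∀
      negate₂ : ∀ t → - t * + 0 + + 2 * - + 1 + + 2 * + 0 * t ≡ - + 2
      negate₂ = solve-∀

    ι2-cancel : ∀ {x y} → ι (+ 2) · x ≋ ι (+ 2) · y → x ≋ y
    ι2-cancel {x} {y} 2x≋2y = begin
      x                            ≈⟨ *-identityˡ x ⟨
      one · x                      ≈⟨ *-congʳ {x} half·2≋1 ⟨
      ι (+ suc k) · ι (+ 2) · x    ≈⟨ *-assoc (ι (+ suc k)) (ι (+ 2)) x ⟩
      ι (+ suc k) · (ι (+ 2) · x)  ≈⟨ *-congˡ {ι (+ suc k)} 2x≋2y ⟩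
      ι (+ suc k) · (ι (+ 2) · y)  ≈⟨ *-assoc (ι (+ suc k)) (ι (+ 2)) y ⟨
      ι (+ suc k) · ι (+ 2) · y    ≈⟨ *-congʳ {y} half·2≋1 ⟩
      one · y                      ≈⟨ *-identityˡ y ⟩
      y                            ∎
      where
      half·2≋1 : ι (+ suc k) · ι (+ 2) ≋ one
      half·2≋1 = trans (reflexive (ι-· (+ suc k) (+ 2)))
        (ℤₙ.mod (divides (+ 1) (≡.trans (twice-half (+ k)) (cong (λ n → + 1 * + n) (≡.sym N≡1+2k)))) , ℤₙ.refl)
        where
        twice-half : ∀ k → (+ 1 + k) * + 2 - + 1 ≡ + 1 * (+ 1 + (k + k))
        twice-half = solve-∀

    -- Frobenius fixes ℤ and sends θ = 2 ω - t to -θ; halving gives ω ^ N = t - ω.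
    ω^N≋conjω : ω ^ N ≋ conj ω
    ω^N≋conjω = ι2-cancel (+-cancelˡ (ι (- t)) _ _ (begin
      add (ι (- t)) (ι (+ 2) · ω ^ N)        ≈⟨ +-cong (frobenius-ι (- t))
                                                    (trans (^-distrib-* (ι (+ 2)) ω N) (*-congʳ {ω ^ N} (frobenius-ι (+ 2)))) ⟨
      add (ι (- t) ^ N) ((ι (+ 2) · ω) ^ N)  ≈⟨ frobenius-+ (ι (- t)) (ι (+ 2) · ω) ⟨
      add (ι (- t)) (ι (+ 2) · ω) ^ N        ≡⟨ cong (_^ N) (ι-·ω (- t) (+ 2)) ⟩
      θ ^ N                                  ≈⟨ θ^N≋-θ ⟩
      neg θ                                  ≡⟨ cong₂ _,_ (conjugate₁ t s) (conjugate₂ t) ⟩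
      add (ι (- t)) (ι (+ 2) · conj ω)       ∎))
      where
      conjugate₁ : ∀ t s → - - t ≡ - t + (+ 2 * (+ 0 + + 1 * t) + + 0 * - + 1 * s)
      conjugate₁ = solve-∀
      conjugate₂ : ∀ t → - + 2 ≡ + 0 + (+ 2 * - + 1 + + 0 * (+ 0 + + 1 * t) + + 0 * - + 1 * t)
      conjugate₂ = solve-∀

    frobenius : ∀ x → x ^ N ≋ conj x
    frobenius (a , b) = begin
      (a , b) ^ N                      ≡⟨ cong (_^ N) (ι-·ω a b) ⟨
      add (ι a) (ι b · ω) ^ N          ≈⟨ frobenius-+ (ι a) (ι b · ω) ⟩
      add (ι a ^ N) ((ι b · ω) ^ N)    ≈⟨ +-cong (frobenius-ι a)
                                            (trans (^-distrib-* (ι b) ω N) (*-cong (frobenius-ι b) ω^N≋conjω)) ⟩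
      add (ι a) (ι b · conj ω)         ≡⟨ cong₂ _,_ (conjugate₁ t s a b) (conjugate₂ t b) ⟩
      conj (a , b)                     ∎
      where
      conjugate₁ : ∀ t s a b → a + (b * (+ 0 + + 1 * t) + + 0 * - + 1 * s) ≡ a + b * t
      conjugate₁ = solve-∀
      conjugate₂ : ∀ t b → + 0 + (b * - + 1 + + 0 * (+ 0 + + 1 * t) + + 0 * - + 1 * t) ≡ - b
      conjugate₂ = solve-∀

    ^[N+1]≋ι-norm : ∀ x → x ^ suc N ≋ ι (normQ x)
    ^[N+1]≋ι-norm x = trans (*-congˡ {x} (frobenius x)) (reflexive (·-conj x))


-- Trial division and the Jacobi symbol

factorsAux-1 : ∀ f e → factorsAux f e 1 ≡ []
factorsAux-1 zero    e = ≡.refl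
factorsAux-1 (suc f) e = ≡.refl

trial-division : ∀ {N} → Prime N → ∀ f e k → suc (suc e) ℕ.+ k ≡ N → k ℕ.< f → factorsAux f e N ≡ N ∷ []
trial-division _ (suc f) e zero ≡.refl _ rewrite ℕP.+-identityʳ e
  | n%n≡0 (suc (suc e)) {{ℕ.nonZero}} | n/n≡1 (suc (suc e)) {{ℕ.nonZero}} =
  cong (suc (suc e) ∷_) (factorsAux-1 f e)
trial-division N-prime (suc f) e (suc k) ≡.refl (s≤s k<f)
  with (suc (suc e) ℕ.+ suc k) ℕ.% suc (suc e) ≡ᵇ 0 in d∣N
... | true  = contradiction (composite d<N (m%n≡0⇒n∣m _ (suc (suc e)) (ℕP.≡ᵇ⇒≡ _ 0 (subst T (≡.sym d∣N) _))))
                (Prime.notComposite N-prime)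
  where
  d<N : suc (suc e) ℕ.< suc (suc e) ℕ.+ suc k
  d<N = ℕP.m<m+n (suc (suc e)) (s≤s z≤n)
... | false = trial-division N-prime f (suc e) k (≡.sym (ℕP.+-suc (suc (suc e)) k)) k<f

primeFactors-prime : ∀ {N} → Prime N → primeFactors N ≡ N ∷ []
primeFactors-prime {N} N-prime = trial-division N-prime (2 ℕ.* N ℕ.+ 2) 0 (N ∸ 2)
  (ℕP.m+[n∸m]≡n (prime≥2 N-prime))
  (ℕP.≤-<-trans (ℕP.m∸n≤m N 2) (ℕP.≤-<-trans (ℕP.m≤n*m N 2) (ℕP.m<m+n (2 ℕ.* N) (s≤s z≤n))))

jacobi≡legendre : ∀ a {N} → Prime N → jacobi a N ≡ legendre a N
jacobi≡legendre a {N} N-prime rewrite primeFactors-prime N-prime = ℤ.*-identityʳ (legendre a N)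

legendre≡-1⇒¬square : ∀ {a N} → Prime N → legendre a N ≡ - + 1 → ¬ Mod.IsSquare N a
legendre≡-1⇒¬square {a} {suc q} N-prime legendre≡-1 (y , y²≈a) =
  subst T (no-root-listed legendre≡-1) (any⁺ is-root (lose (∈-upTo⁺ (n%ℕd<d y N)) y%N-is-root))
  where
  open import Data.Integer using (_*_)
  open PrimeModulus (suc q) N-prime
  N : ℕ
  N = suc q

  is-root : ℕ → Bool
  is-root x = ((+ x * + x - a) %ℕ N) ≡ᵇ 0

  no-root-listed : (if (a %ℕ N) ≡ᵇ 0 then + 0 else if any is-root (upTo N) then + 1 else - + 1) ≡ - + 1 →
                   any is-root (upTo N) ≡ false
  no-root-listed with (a %ℕ N) ≡ᵇ 0 | any is-root (upTo N)
  ... | false | false = λ _ → ≡.refl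
  ... | false | true  = λ ()
  ... | true  | _     = λ ()

  y%N-is-root : T (is-root (y %ℕ N))
  y%N-is-root = ℕP.≡⇒≡ᵇ _ 0 (≈0⇒%ℕ≡0 (x≈y⇒x∙y⁻¹≈ε (trans (*-cong (sym (≈-%ℕ y)) (sym (≈-%ℕ y))) y²≈a)))

-- The quadratic rings of Defs

/ℕ4-exact : ∀ x q → x ≡ q ℤ.* + 4 → x /ℕ 4 ≡ q
/ℕ4-exact x q x≡q*4 = ℤ.*-cancelʳ-≡ (x /ℕ 4) q (+ 4) (begin
  x /ℕ 4 ℤ.* + 4                ≡⟨ ℤ.+-identityˡ (x /ℕ 4 ℤ.* + 4) ⟨
  + 0 + x /ℕ 4 ℤ.* + 4          ≡⟨ cong (λ r → + r + x /ℕ 4 ℤ.* + 4) x%4≡0 ⟨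
  + (x %ℕ 4) + x /ℕ 4 ℤ.* + 4   ≡⟨ a≡a%ℕn+[a/ℕn]*n x 4 ⟨
  x                             ≡⟨ x≡q*4 ⟩
  q ℤ.* + 4                     ∎)
  where
  open ≡-Reasoning
  x%4≡0 : x %ℕ 4 ≡ 0
  x%4≡0 = Mod.≈0⇒%ℕ≡0 4 {x} (Mod.mod (divides q (≡.trans (ℤ.+-identityʳ x) x≡q*4)))

-- Defs works in ℤ[ω] for ω = √D, or ω = (1 + √D) / 2 when D ≡ 1 (mod 4);
-- then ω² = ω-trace D · ω + ω-constant D.
ω-trace : ℤ → ℤ
ω-trace D = if D≡1mod4 D then + 1 else + 0

ω-constant : ℤ → ℤ
ω-constant D = if D≡1mod4 D then (D - + 1) /ℕ 4 else D

module Encoding (D : ℤ) where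

  open import Data.Integer using (_*_)
  open Quadratic (ω-trace D) (ω-constant D)

  mul≡· : ∀ x y → mul D x y ≡ x · y
  mul≡· (a , b) (c , d) with D≡1mod4 D
  ... | true  = cong₂ _,_ ≡.refl (times-one (a * d + b * c) (b * d))
    where
    times-one : ∀ u v → u + v ≡ u + v * + 1
    times-one = solve-∀
  ... | false = cong₂ _,_ (reorder D a b c d) (plus-zero (a * d + b * c) (b * d))
    where
    reorder : ∀ D a b c d → a * c + D * b * d ≡ a * c + b * d * D
    reorder = solve-∀
    plus-zero : ∀ u v → u ≡ u + v * + 0
    plus-zero = solve-∀

  module _ (D≡1 : D≡1mod4 D ≡ true) where

    private
      q : ℤ
      q = D /ℕ 4

      D≡1+q*4 : D ≡ + 1 + q * + 4
      D≡1+q*4 = ≡.trans (a≡a%ℕn+[a/ℕn]*n D 4)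
        (cong (λ r → + r + q * + 4) (ℕP.≡ᵇ⇒≡ _ 1 (subst T (≡.sym D≡1) _)))

    [D-1]/4≡q : (D - + 1) /ℕ 4 ≡ q
    [D-1]/4≡q = /ℕ4-exact (D - + 1) q (≡.trans (cong (_- + 1) D≡1+q*4) (shift q))
      where
      shift : ∀ q → + 1 + q * + 4 - + 1 ≡ q * + 4
      shift = solve-∀

    [1-D]/4≡-q : (+ 1 - D) /ℕ 4 ≡ - q
    [1-D]/4≡-q = /ℕ4-exact (+ 1 - D) (- q) (≡.trans (cong (λ d → + 1 - d) D≡1+q*4) (shift q))
      where
      shift : ∀ q → + 1 - (+ 1 + q * + 4) ≡ - q * + 4
      shift = solve-∀

    ω-trace≡1 : ω-trace D ≡ + 1
    ω-trace≡1 = cong (λ b → if b then + 1 else + 0) D≡1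

    ω-constant≡q : ω-constant D ≡ q
    ω-constant≡q = ≡.trans (cong (λ b → if b then (D - + 1) /ℕ 4 else D) D≡1) [D-1]/4≡q

    Δ≡D : Δ ≡ D
    Δ≡D = ≡.trans (cong₂ (λ t s → t * t + + 4 * s) ω-trace≡1 ω-constant≡q)
      (≡.sym (≡.trans D≡1+q*4 (discriminant q)))
      where
      discriminant : ∀ q → + 1 + q * + 4 ≡ + 1 * + 1 + + 4 * q
      discriminant = solve-∀

    norm≡normQ-1 : ∀ x → norm D x ≡ normQ x
    norm≡normQ-1 (a , b) = begin
      norm D (a , b)                        ≡⟨ cong (λ b′ → if b′ then a * a + a * b + ((+ 1 - D) /ℕ 4) * b * b
                                                         else a * a - D * b * b) D≡1 ⟩
      a * a + a * b + ((+ 1 - D) /ℕ 4) * b * b ≡⟨ cong (λ r → a * a + a * b + r * b * b) [1-D]/4≡-q ⟩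
      a * a + a * b + - q * b * b           ≡⟨ rearrange a b q ⟩
      a * a + + 1 * a * b - q * b * b       ≡⟨ cong₂ (λ t s → a * a + t * a * b - s * b * b) ω-trace≡1 ω-constant≡q ⟨
      normQ (a , b)                         ∎
      where
      open ≡-Reasoning
      rearrange : ∀ a b q → a * a + a * b + - q * b * b ≡ a * a + + 1 * a * b - q * b * b
      rearrange = solve-∀

  module _ (D≢1 : D≡1mod4 D ≡ false) where

    Δ≡4D : Δ ≡ + 2 * + 2 * D
    Δ≡4D = ≡.trans (cong₂ (λ t s → t * t + + 4 * s)
                      (cong (λ b → if b then + 1 else + 0) D≢1)
                      (cong (λ b → if b then (D - + 1) /ℕ 4 else D) D≢1))
                   (discriminant D)
      where
      discriminant : ∀ D → + 0 * + 0 + + 4 * D ≡ + 2 * + 2 * D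
      discriminant = solve-∀

    norm≡normQ-≢1 : ∀ x → norm D x ≡ normQ x
    norm≡normQ-≢1 (a , b) = ≡.trans
      (cong (λ b′ → if b′ then a * a + a * b + ((+ 1 - D) /ℕ 4) * b * b else a * a - D * b * b) D≢1)
      (≡.trans (rearrange D a b)
        (cong₂ (λ t s → a * a + t * a * b - s * b * b)
          (cong (λ b′ → if b′ then + 1 else + 0) (≡.sym D≢1))
          (cong (λ b′ → if b′ then (D - + 1) /ℕ 4 else D) (≡.sym D≢1))))
      where
      rearrange : ∀ D a b → a * a - D * b * b ≡ a * a + + 0 * a * b - D * b * b
      rearrange = solve-∀

  by-residue : ∀ {P : Set} → (D≡1mod4 D ≡ true → P) → (D≡1mod4 D ≡ false → P) → P
  by-residue {P} if≡1 if≢1 = by-value (D≡1mod4 D) ≡.refl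
    where
    by-value : ∀ b → D≡1mod4 D ≡ b → P
    by-value true  = if≡1
    by-value false = if≢1

  norm≡normQ : ∀ x → norm D x ≡ normQ x
  norm≡normQ x = by-residue (λ D≡1 → norm≡normQ-1 D≡1 x) (λ D≢1 → norm≡normQ-≢1 D≢1 x)

  Δ-nonsquare : ∀ {N} (N-prime : Prime N) → ¬ Mod._≈_ N (+ 2) (+ 0) → ¬ Mod.IsSquare N D → ¬ Mod.IsSquare N Δ
  Δ-nonsquare {N} N-prime 2≉0 D-nonsquare = by-residue
    (λ D≡1 → subst (¬_ ∘ Mod.IsSquare N) (≡.sym (Δ≡D D≡1)) D-nonsquare)
    (λ D≢1 → subst (¬_ ∘ Mod.IsSquare N) (≡.sym (Δ≡4D D≢1))
      (PrimeModulus.¬square-scale N N-prime D-nonsquare 2≉0))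

  module _ (N : ℕ) where
    open Modulo N
    open CommutativeRing ℤ[ω]-mod using (refl; trans; reflexive; +-cong; *-congˡ)
    open import Algebra.Properties.Semiring.Exp (CommutativeRing.semiring ℤ[ω]-mod) using (_^_)
    open RootsOfUnity ℤ[ω]-mod using (geometric)

    pow≋^ : ∀ w m → pow D w m ≋ w ^ m
    pow≋^ w zero    = refl
    pow≋^ w (suc m) = trans (reflexive (mul≡· w (pow D w m))) (*-congˡ {w} (pow≋^ w m))

    cyclo≋geometric : ∀ m x → cyclo D m x ≋ geometric m x
    cyclo≋geometric zero    x = refl
    cyclo≋geometric (suc m) x = +-cong (pow≋^ x m) (cyclo≋geometric m x)

    ≋⇒≡[_] : ∀ {x y} → x ≋ y → x ≡[ N ] y
    ≋⇒≡[_] (x₁≈y₁ , x₂≈y₂) = Mod.≈⇒≡ℤ N x₁≈y₁ , Mod.≈⇒≡ℤ N x₂≈y₂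

odd⇒≡1+2h : ∀ {N} → N ℕ.% 2 ≡ 1 → N ≡ suc (N ℕ./ 2 ℕ.+ N ℕ./ 2)
odd⇒≡1+2h {N} N%2≡1 = ≡.trans (m≡m%n+[m/n]*n N 2)
  (cong₂ ℕ._+_ N%2≡1 (≡.trans (ℕP.*-comm (N ℕ./ 2) 2) (cong (N ℕ./ 2 ℕ.+_) (ℕP.+-identityʳ (N ℕ./ 2)))))

module _ (D : ℤ) {N : ℕ} (N-prime : Prime N) (N-odd : N ℕ.% 2 ≡ 1) (D-nonsquare : ¬ Mod.IsSquare N D) where

  private
    module ℤₙ = PrimeModulus N N-prime

    2<N : 2 ℕ.< N
    2<N = ℕP.≤∧≢⇒< (prime≥2 N-prime) λ 2≡N → ℕP.0≢1+n (subst (λ n → n ℕ.% 2 ≡ 1) (≡.sym 2≡N) N-odd)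

  open Encoding D
  open Quadratic (ω-trace D) (ω-constant D) using (ι)
  open QuadraticModPrime (ω-trace D) (ω-constant D) N N-prime
    (Δ-nonsquare N-prime (ℤₙ.unit-residue (s≤s z≤n) 2<N) D-nonsquare)
  open Odd (N ℕ./ 2) (odd⇒≡1+2h N-odd)
  open RootsOfUnity ℤ[ω]-mod using (geometric; geometric-cong; order-chain)

  ^[N+1]≋one : ∀ w → InG N D w → w ^ suc N ≋ one
  ^[N+1]≋one w w∈G = trans (^[N+1]≋ι-norm w)
    (trans (reflexive (cong ι (≡.sym (norm≡normQ w)))) (Mod.≡ℤ⇒≈ N w∈G , ℤₙ.refl))

  cyclotomic-chain : ∀ u p ℓ w → InG N D w → suc N ≡ u ℕ.* p ℕ.^ ℓ →
    pow D w u ≡[ N ] one ⊎ ∃ λ j → j ℕ.< ℓ × cyclo D p (pow D w (u ℕ.* p ℕ.^ j)) ≡[ N ] zeroE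
  cyclotomic-chain u p ℓ w w∈G N+1≡upℓ =
    Sum.map (λ w^u≋1 → ≋⇒≡[ N ] (trans (pow≋^ N w u) w^u≋1))
            (λ (j , j<ℓ , Φ≋0) → j , j<ℓ , ≋⇒≡[ N ] (trans (cyclo≋geometric N p _)
               (trans (geometric-cong p (pow≋^ N w (u ℕ.* p ℕ.^ j))) Φ≋0)))
            (order-chain no-zero-divisors u p ℓ w (subst (λ e → w ^ e ≋ one) N+1≡upℓ (^[N+1]≋one w w∈G)))

suc-of-∸1 : ∀ {N} M → 0 ℕ.< N → N ≡ M ∸ 1 → suc N ≡ M
suc-of-∸1 zero    N>0 ≡.refl = contradiction N>0 λ ()
suc-of-∸1 (suc M) _   N≡M    = cong suc N≡M

open import Data.Nat using (_*_; _^_; _<_; _%_)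

theorem1p3 : (D : ℤ) → SquareFree D → D ≢ + 1 →
    (p : ℕ) → Prime p → p % 2 ≡ 1 →
    (k ℓ c : ℕ) → 0 < k → 0 < ℓ → 0 < c → gcd (c * k) p ≡ 1 →
    (N : ℕ) → N ≡ c * k * p ^ ℓ ∸ 1 → Prime N → N % 2 ≡ 1 →
    jacobi D N ≡ - (+ 1) →
    (w : Elt) → InG N D w →
      (pow D w (c * k) ≡[ N ] one)
      ⊎ (Σ ℕ λ j → (j < ℓ) × (cyclo D p (pow D w (c * k * p ^ j)) ≡[ N ] zeroE))
theorem1p3 D _ _ p _ _ k ℓ c _ _ _ _ N N≡ckpℓ-1 N-prime N-odd jacobi≡-1 w w∈G =
  cyclotomic-chain D N-prime N-odd D-nonsquare (c * k) p ℓ w w∈G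
    (suc-of-∸1 (c * k * p ^ ℓ) (ℕP.<-trans (s≤s z≤n) (prime≥2 N-prime)) N≡ckpℓ-1)
  where
  D-nonsquare : ¬ Mod.IsSquare N D
  D-nonsquare = legendre≡-1⇒¬square N-prime (≡.trans (≡.sym (jacobi≡legendre D N-prime)) jacobi≡-1)
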